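{- Let $\bm{\gamma}=(\gamma_0,\gamma_1,\ldots)\in\{0,1\}^{\infty}$, let $A\subseteq\mathbb{Z}_{\geq0}$ be finite, and let $m=\mathrm{mex}\,A$. Then $\{{\ast}^{\bm{\gamma}}i:i\in A\}^{\gamma_m}={\ast}^{\bm{\gamma}}m$ if and only if either $\gamma_i=0$ for some $i\le m$, or $\gamma_i=1$ for every $i\in A$.
   Context: Let $\mathcal{B}=\{0,1\}$. Define $\mathbb{I}_0=\{\emptyset\}\times\mathcal{B}$ and $\mathbb{I}_n=2^{\mathbb{I}_{n-1}}\times\mathcal{B}$ for $n\ge1$; a game with activeness is an element of $\mathbb{I}=\bigcup_{n\ge0}\mathbb{I}_n$. A pair $(G,g)$ is written $G^g$; elements of $G$ are its options, $g=1$ meaning active. The outcome $o$ is defined recursively: $o(G^g)=\mathscr{N}$ if $g=1$ and some option has outcome $\mathscr{P}$, and $o(G^g)=\mathscr{P}$ otherwise. The sum is $G^g+H^h=(\{G'^{g'}+H^h:G'^{g'}\in G^g\}\cup\{G^g+H'^{h'}:H'^{h'}\in H^h\})^{\max\{g,h\}}$. $G^g=H^h$ means $o(G^g+X^x)=o(H^h+X^x)$ for all games $X^x$. For $\bm{\gamma}=(\gamma_0,\gamma_1,\ldots)\in\mathcal{B}^\infty$, the nimbers are defined recursively by ${\ast}^{\bm{\gamma}}i=\{{\ast}^{\bm{\gamma}}j:0\le j<i\}^{\gamma_i}$. $\mathrm{mex}\,A=\min(\mathbb{Z}_{\ge0}\setminus A)$. -}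

module Defs where

open import Data.Bool using (Bool; true; false; _∧_; _∨_; not)
open import Data.Nat using (ℕ; zero; suc; _<_)
open import Data.List using (List; []; _∷_; _++_; [_]; map)
open import Data.List.Membership.Propositional using (_∈_; _∉_)
open import Relation.Binary.PropositionalEquality using (_≡_)

-- Games with activeness: a finite collection of options and an activeness bit
-- (true = active).  Options are kept as a list; since the outcome and the sum
-- only depend on the options via membership, this is faithful.
data Game : Set where
  mk : List Game → Bool → Game

mutual
  isN : Game → Bool
  isN (mk opts g) = g ∧ someP opts

  someP : List Game → Bool
  someP [] = false
  someP (x ∷ xs) = not (isN x) ∨ someP xs

mutual
  _⊕_ : Game → Game → Game
  G@(mk gs g) ⊕ H@(mk hs h) = mk (sumL gs H ++ sumR G hs) (g ∨ h)

  sumL : List Game → Game → List Game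
  sumL [] H = []
  sumL (x ∷ xs) H = (x ⊕ H) ∷ sumL xs H

  sumR : Game → List Game → List Game
  sumR G [] = []
  sumR G (y ∷ ys) = (G ⊕ y) ∷ sumR G ys

infixl 6 _⊕_

_≈_ : Game → Game → Set
G ≈ H = ∀ X → isN (G ⊕ X) ≡ isN (H ⊕ X)

infix 4 _≈_

mutual
  nim : (ℕ → Bool) → ℕ → Game
  nim γ i = mk (nimOpts γ i) (γ i)

  nimOpts : (ℕ → Bool) → ℕ → List Game
  nimOpts γ zero = []
  nimOpts γ (suc i) = nimOpts γ i ++ [ nim γ i ]

IsMex : List ℕ → ℕ → Set
IsMex A m = m ∉ A × (∀ i → i < m → i ∈ A)
  where open import Data.Product using (_×_)

-- The two games have the same activeness γ_m, and by minimality of m every option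
-- *j (j < m) of *m is also an option of the left game, so a difference can only
-- come from an option *a with a > m.  In a sum with any X such a move is harmless:
-- if *a + X is active, its own option *m + X answers it; if it is inactive, then
-- γ_a = 0 and X is inactive, so by hypothesis some γ_i = 0 with i ≤ m, and either
-- i < m and the inactive *i + X is an equally good move in *m + X, or i = m and
-- both sums are inactive.
-- Conversely, if γ_i = 1 for all i ≤ m and γ_a = 0 for some a ∈ A, the test game
-- X = {*j : j < m}⁰ separates the two: *m + X is a 𝒫-position because every
-- move has a mirror answer ending in some *j + *j, whereas in the left sum the
-- move to the inactive *a + X wins.
module Submission where

open import Defs
open import Data.Bool using (Bool; true; false; _∧_; _∨_)
open import Data.Bool.Properties using (_≟_; ∧-zeroʳ; ∨-zeroʳ; ∨-conicalˡ; ∨-conicalʳ; ¬-not)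
open import Data.Nat using (ℕ; _≤_; _<_; suc; s≤s)
open import Data.Nat.Properties
  using (≤-refl; <⇒≤; <-cmp; n<1+n; m<n⇒m<1+n; m<1+n⇒m<n∨m≡n; m≤n⇒m<n∨m≡n; anyUpTo?)
open import Data.List using (List; []; _∷_; map)
open import Data.List.Membership.Propositional using (_∈_)
open import Data.List.Membership.Propositional.Properties
  using (∈-map⁺; ∈-map⁻; ∈-++⁺ˡ; ∈-++⁺ʳ; ∈-++⁻)
open import Data.List.Relation.Unary.Any using (here; there)
open import Data.List.Relation.Unary.All as All using (All; []; _∷_)
open import Data.Product using (_×_; ∃; _,_)
open import Data.Sum using (_⊎_; inj₁; inj₂)
open import Data.Empty using (⊥-elim)
open import Function.Bundles using (_⇔_; mk⇔)
open import Relation.Binary.PropositionalEquality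
  using (_≡_; refl; sym; trans; cong; subst)
open import Relation.Binary.Definitions using (tri<; tri≈; tri>)
open import Relation.Nullary using (¬_; yes; no)

options : Game → List Game
options (mk os _) = os

active : Game → Bool
active (mk _ g) = g

module _ (P : Game → Set) (step : ∀ os g → (∀ {o} → o ∈ os → P o) → P (mk os g)) where
  mutual
    game-ind : ∀ G → P G
    game-ind (mk os g) = step os g (All.lookup (game-ind-all os))

    game-ind-all : ∀ os → All P os
    game-ind-all []       = []
    game-ind-all (o ∷ os) = game-ind o ∷ game-ind-all os

true⇔true⇒≡ : ∀ {a b} → (a ≡ true → b ≡ true) → (b ≡ true → a ≡ true) → a ≡ b
true⇔true⇒≡ {true}  {true}  _ _ = refl
true⇔true⇒≡ {true}  {false} f _ = sym (f refl)
true⇔true⇒≡ {false} {true}  _ g = g refl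
true⇔true⇒≡ {false} {false} _ _ = refl

someP-intro : ∀ {z xs} → z ∈ xs → isN z ≡ false → someP xs ≡ true
someP-intro (here refl) zP rewrite zP = refl
someP-intro {xs = y ∷ _} (there z∈) zP =
  trans (cong (_ ∨_) (someP-intro z∈ zP)) (∨-zeroʳ _)

someP-elim : ∀ xs → someP xs ≡ true → ∃ λ z → z ∈ xs × isN z ≡ false
someP-elim (y ∷ ys) h with isN y in yN
... | false = y , here refl , yN
... | true with someP-elim ys h
...   | z , z∈ , zP = z , there z∈ , zP

someP-reject : ∀ xs → (∀ {z} → z ∈ xs → isN z ≡ true) → someP xs ≡ false
someP-reject []       _  = refl
someP-reject (y ∷ ys) allN rewrite allN (here refl) =
  someP-reject ys (λ z∈ → allN (there z∈))

isN-intro : ∀ G {z} → active G ≡ true → z ∈ options G → isN z ≡ false → isN G ≡ true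
isN-intro (mk _ _) refl z∈ zP = someP-intro z∈ zP

isN-elim : ∀ {G} → isN G ≡ true →
           active G ≡ true × ∃ λ z → z ∈ options G × isN z ≡ false
isN-elim {mk os true} h = refl , someP-elim os h

isP-intro : ∀ {G} → (∀ {z} → z ∈ options G → isN z ≡ true) → isN G ≡ false
isP-intro {mk os g} allN = trans (cong (g ∧_) (someP-reject os allN)) (∧-zeroʳ g)

isP-inactive : ∀ G → active G ≡ false → isN G ≡ false
isP-inactive (mk _ _) refl = refl

isP-option-isN : ∀ {G z} → isN G ≡ false → active G ≡ true → z ∈ options G → isN z ≡ true
isP-option-isN {G} {z} GP act z∈ with isN z in zN
... | true  = refl
... | false with trans (sym (isN-intro G act z∈ zN)) GP
...   | ()

sumL≡map : ∀ gs H → sumL gs H ≡ map (_⊕ H) gs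
sumL≡map []       H = refl
sumL≡map (g ∷ gs) H = cong ((g ⊕ H) ∷_) (sumL≡map gs H)

sumR≡map : ∀ G hs → sumR G hs ≡ map (G ⊕_) hs
sumR≡map G []       = refl
sumR≡map G (h ∷ hs) = cong ((G ⊕ h) ∷_) (sumR≡map G hs)

active-⊕ : ∀ G H → active (G ⊕ H) ≡ active G ∨ active H
active-⊕ (mk _ _) (mk _ _) = refl

⊕-optionˡ : ∀ G H {G'} → G' ∈ options G → G' ⊕ H ∈ options (G ⊕ H)
⊕-optionˡ (mk gs _) H@(mk _ _) G'∈ =
  ∈-++⁺ˡ (subst (_ ∈_) (sym (sumL≡map gs H)) (∈-map⁺ (_⊕ H) G'∈))

⊕-optionʳ : ∀ G H {H'} → H' ∈ options H → G ⊕ H' ∈ options (G ⊕ H)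
⊕-optionʳ G@(mk gs _) (mk hs _) H'∈ =
  ∈-++⁺ʳ (sumL gs _) (subst (_ ∈_) (sym (sumR≡map G hs)) (∈-map⁺ (G ⊕_) H'∈))

⊕-option⁻ : ∀ G H {z} → z ∈ options (G ⊕ H) →
            (∃ λ G' → G' ∈ options G × z ≡ G' ⊕ H) ⊎ (∃ λ H' → H' ∈ options H × z ≡ G ⊕ H')
⊕-option⁻ G@(mk gs _) H@(mk hs _) z∈ with ∈-++⁻ (sumL gs H) z∈
... | inj₁ z∈ˡ = inj₁ (∈-map⁻ (_⊕ H) (subst (_ ∈_) (sumL≡map gs H) z∈ˡ))
... | inj₂ z∈ʳ = inj₂ (∈-map⁻ (G ⊕_) (subst (_ ∈_) (sumR≡map G hs) z∈ʳ))

⊕-mirror-isP : ∀ G → isN (G ⊕ G) ≡ false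
⊕-mirror-isP = game-ind (λ G → isN (G ⊕ G) ≡ false) step
  where
  step : ∀ os g → (∀ {o} → o ∈ os → isN (o ⊕ o) ≡ false) → isN (mk os g ⊕ mk os g) ≡ false
  step os false _  = refl
  step os true  IH = isP-intro answer
    where
    answer : ∀ {z} → z ∈ options (mk os true ⊕ mk os true) → isN z ≡ true
    answer z∈ with ⊕-option⁻ (mk os true) (mk os true) z∈
    ... | inj₁ (o , o∈ , refl) =
      isN-intro (o ⊕ mk os true) (trans (active-⊕ o _) (∨-zeroʳ _))
                (⊕-optionʳ o (mk os true) o∈) (IH o∈)
    ... | inj₂ (o , o∈ , refl) =
      isN-intro (mk os true ⊕ o) (active-⊕ (mk os true) o)
                (⊕-optionˡ (mk os true) o o∈) (IH o∈)

⊕-deactivated-isP : ∀ {os g} → (∀ {o} → o ∈ os → active o ≡ true) →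
                    isN (mk os g ⊕ mk os false) ≡ false
⊕-deactivated-isP {os} {g} allActive = isP-intro answer
  where
  answer : ∀ {z} → z ∈ options (mk os g ⊕ mk os false) → isN z ≡ true
  answer z∈ with ⊕-option⁻ (mk os g) (mk os false) z∈
  ... | inj₁ (o , o∈ , refl) =
    isN-intro (o ⊕ mk os false) (trans (active-⊕ o _) (cong (_∨ false) (allActive o∈)))
              (⊕-optionʳ o (mk os false) o∈) (⊕-mirror-isP o)
  ... | inj₂ (o , o∈ , refl) =
    isN-intro (mk os g ⊕ o)
              (trans (active-⊕ (mk os g) o) (trans (cong (g ∨_) (allActive o∈)) (∨-zeroʳ g)))
              (⊕-optionˡ (mk os g) o o∈) (⊕-mirror-isP o)

≈-intro : ∀ {gs hs g} → (∀ {z} → z ∈ hs → z ∈ gs) →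
          (∀ {G'} X → G' ∈ gs → g ∨ active X ≡ true → isN (G' ⊕ X) ≡ false →
             isN (mk hs g ⊕ X) ≡ true) →
          mk gs g ≈ mk hs g
≈-intro {gs} {hs} {g} hs⊆gs reversible = game-ind Same step
  where
  G H : Game
  G = mk gs g
  H = mk hs g

  Same : Game → Set
  Same X = isN (G ⊕ X) ≡ isN (H ⊕ X)

  step : ∀ xs x → (∀ {X'} → X' ∈ xs → Same X') → Same (mk xs x)
  step xs x IH = true⇔true⇒≡ G→H H→G
    where
    X = mk xs x

    G→H : isN (G ⊕ X) ≡ true → isN (H ⊕ X) ≡ true
    G→H GX with isN-elim GX
    ... | act , z , z∈ , zP with ⊕-option⁻ G X z∈
    ...   | inj₁ (G' , G'∈ , refl) = reversible X G'∈ act zP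
    ...   | inj₂ (X' , X'∈ , refl) =
      isN-intro (H ⊕ X) act (⊕-optionʳ H X X'∈) (trans (sym (IH X'∈)) zP)

    H→G : isN (H ⊕ X) ≡ true → isN (G ⊕ X) ≡ true
    H→G HX with isN-elim HX
    ... | act , z , z∈ , zP with ⊕-option⁻ H X z∈
    ...   | inj₁ (H' , H'∈ , refl) = isN-intro (G ⊕ X) act (⊕-optionˡ G X (hs⊆gs H'∈)) zP
    ...   | inj₂ (X' , X'∈ , refl) =
      isN-intro (G ⊕ X) act (⊕-optionʳ G X X'∈) (trans (IH X'∈) zP)

module _ (γ : ℕ → Bool) where

  nim∈nimOpts : ∀ {i j} → j < i → nim γ j ∈ nimOpts γ i
  nim∈nimOpts {suc i} j<1+i with m<1+n⇒m<n∨m≡n j<1+i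
  ... | inj₁ j<i  = ∈-++⁺ˡ (nim∈nimOpts j<i)
  ... | inj₂ refl = ∈-++⁺ʳ (nimOpts γ i) (here refl)

  nimOpts-∈⁻ : ∀ i {z} → z ∈ nimOpts γ i → ∃ λ j → j < i × z ≡ nim γ j
  nimOpts-∈⁻ (suc i) z∈ with ∈-++⁻ (nimOpts γ i) z∈
  ... | inj₂ (here refl) = i , n<1+n i , refl
  ... | inj₁ z∈ˡ with nimOpts-∈⁻ i z∈ˡ
  ...   | j , j<i , z≡ = j , m<n⇒m<1+n j<i , z≡

  nim-⊕-isN-by-inactive : ∀ {i m xs x} → i ≤ m → γ i ≡ false → x ≡ false →
                          γ m ∨ x ≡ true → isN (nim γ m ⊕ mk xs x) ≡ true
  nim-⊕-isN-by-inactive {i} {m} {xs} i≤m γi refl act with m≤n⇒m<n∨m≡n i≤m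
  ... | inj₁ i<m = isN-intro (nim γ m ⊕ X) act (⊕-optionˡ (nim γ m) X (nim∈nimOpts i<m))
                     (isP-inactive (nim γ i ⊕ X) (cong (_∨ false) γi))
    where X = mk xs false
  ... | inj₂ refl with trans (sym act) (cong (_∨ false) γi)
  ...   | ()

  nim-reversible : ∀ {A m} → IsMex A m →
                   (∃ λ i → i ≤ m × γ i ≡ false) ⊎ (∀ i → i ∈ A → γ i ≡ true) →
                   ∀ {a} X → a ∈ A → γ m ∨ active X ≡ true → isN (nim γ a ⊕ X) ≡ false →
                   isN (nim γ m ⊕ X) ≡ true
  nim-reversible {m = m} (m∉A , _) cond {a} X@(mk xs x) a∈A act aX-isP with <-cmp a m
  ... | tri< a<m _ _ =
    isN-intro (nim γ m ⊕ X) act (⊕-optionˡ (nim γ m) X (nim∈nimOpts a<m)) aX-isP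
  ... | tri≈ _ refl _ = ⊥-elim (m∉A a∈A)
  ... | tri> _ _ m<a with γ a ∨ x ≟ true
  ...   | yes aX-active =
    isP-option-isN aX-isP aX-active (⊕-optionˡ (nim γ a) X (nim∈nimOpts m<a))
  ...   | no aX-inactive with cond
  ...     | inj₁ (i , i≤m , γi) =
    nim-⊕-isN-by-inactive i≤m γi (∨-conicalʳ (γ a) x (¬-not aX-inactive)) act
  ...     | inj₂ allTrue
    with trans (sym (allTrue a a∈A)) (∨-conicalˡ (γ a) x (¬-not aX-inactive))
  ...       | ()

  nimSet≈nim : ∀ {A m} → IsMex A m →
               (∃ λ i → i ≤ m × γ i ≡ false) ⊎ (∀ i → i ∈ A → γ i ≡ true) →
               mk (map (nim γ) A) (γ m) ≈ nim γ m
  nimSet≈nim {A} {m} mex@(_ , below∈A) cond = ≈-intro below-mex reversible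
    where
    below-mex : ∀ {z} → z ∈ nimOpts γ m → z ∈ map (nim γ) A
    below-mex z∈ with nimOpts-∈⁻ m z∈
    ... | j , j<m , refl = ∈-map⁺ (nim γ) (below∈A j j<m)

    reversible : ∀ {G'} X → G' ∈ map (nim γ) A → γ m ∨ active X ≡ true →
                 isN (G' ⊕ X) ≡ false → isN (nim γ m ⊕ X) ≡ true
    reversible X G'∈ with ∈-map⁻ (nim γ) G'∈
    ... | a , a∈A , refl = nim-reversible mex cond X a∈A

  nimSet≉nim : ∀ {A m a} → (∀ i → i ≤ m → γ i ≡ true) → a ∈ A → γ a ≡ false →
               ¬ (mk (map (nim γ) A) (γ m) ≈ nim γ m)
  nimSet≉nim {A} {m} {a} low a∈A γa same
    with trans (sym left-isN) (trans (same X) right-isP)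
    where
    X : Game
    X = mk (nimOpts γ m) false

    left-isN : isN (mk (map (nim γ) A) (γ m) ⊕ X) ≡ true
    left-isN = isN-intro (mk (map (nim γ) A) (γ m) ⊕ X) (cong (_∨ false) (low m ≤-refl))
                 (⊕-optionˡ (mk (map (nim γ) A) (γ m)) X (∈-map⁺ (nim γ) a∈A))
                 (isP-inactive (nim γ a ⊕ X) (cong (_∨ false) γa))

    options-active : ∀ {o} → o ∈ nimOpts γ m → active o ≡ true
    options-active o∈ with nimOpts-∈⁻ m o∈
    ... | j , j<m , refl = low j (<⇒≤ j<m)

    right-isP : isN (nim γ m ⊕ X) ≡ false
    right-isP = ⊕-deactivated-isP options-active
  ... | ()

theorem3p50 : (γ : ℕ → Bool) (A : List ℕ) (m : ℕ) → IsMex A m →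
    (mk (map (nim γ) A) (γ m) ≈ nim γ m) ⇔
      ((∃ λ i → i ≤ m × γ i ≡ false) ⊎ (∀ i → i ∈ A → γ i ≡ true))
theorem3p50 γ A m mex = mk⇔ classify (nimSet≈nim γ mex)
  where
  classify : mk (map (nim γ) A) (γ m) ≈ nim γ m →
             (∃ λ i → i ≤ m × γ i ≡ false) ⊎ (∀ i → i ∈ A → γ i ≡ true)
  classify same with anyUpTo? (λ i → γ i ≟ false) (suc m)
  ... | yes (i , s≤s i≤m , γi) = inj₁ (i , i≤m , γi)
  ... | no noFalse = inj₂ λ a a∈A → ¬-not λ γa → nimSet≉nim γ low a∈A γa same
    where
    low : ∀ i → i ≤ m → γ i ≡ true
    low i i≤m = ¬-not λ γi → noFalse (i , s≤s i≤m , γi)
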